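{- Let $a \geq 2$ and $n \geq 1$ be integers, and define rational numbers $G_{m,a}$ ($m \in \mathbb{N}$) by $$\frac{a t}{e^{(a-1)t} + e^{(a-2)t} + \dots + e^{t} + 1} = \sum_{m=0}^{\infty} G_{m,a} \frac{t^m}{m!}$$ in $\mathbb{Q}[[t]]$. Then the denominator of $G_{n,a}$ divides $a^{n-1}$.
   Context: The denominator of a rational number $r$ is the smallest positive integer $d$ with $dr \in \mathbb{Z}$. -}

module Defs where

open import Data.Nat as ℕ using (ℕ; zero; suc; _^_; _!)
open import Data.Nat.Properties using (_!≢0)
open import Data.Integer using (+_)
open import Data.Rational using (ℚ; _/_; _+_; _*_; 0ℚ)

-- Formal power series over ℚ, represented by their (ordinary) coefficients:
-- a series f stands for Σ_m f m · t^m.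
Series : Set
Series = ℕ → ℚ

Σ< : ℕ → (ℕ → ℚ) → ℚ
Σ< zero    f = 0ℚ
Σ< (suc n) f = Σ< n f + f n

_⋆_ : Series → Series → Series
(f ⋆ g) n = Σ< (suc n) (λ k → f k * g (n ℕ.∸ k))

expS : ℕ → Series
expS j m = ((+ (j ^ m)) / (m !)) {{m !≢0}}

denomSeries : ℕ → Series
denomSeries a m = Σ< a (λ j → expS j m)

atSeries : ℕ → Series
atSeries a zero          = 0ℚ
atSeries a (suc zero)    = (+ a) / 1
atSeries a (suc (suc m)) = 0ℚ

egf : (ℕ → ℚ) → Series
egf G m = G m * ((+ 1) / (m !)) {{m !≢0}}

{-# OPTIONS --safe #-}
module Submission where

open import Defs
open import Data.Nat using (ℕ; _≤_; _^_; _∸_)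
open import Data.Nat.Divisibility using (_∣_)
open import Data.Rational using (ℚ)
open import Relation.Binary.PropositionalEquality using (_≡_)

open import Algebra.Properties.Group using (inverseˡ-unique)
open import Data.Nat as ℕ using (zero; suc; _!; _<_; s≤s; NonZero)
import Data.Nat.Properties as ℕ
open import Data.Nat.Properties using (_!≢0)
open import Data.Nat.Combinatorics using (k![n∸k]!∣n!)
open import Data.Nat.Coprimality using (coprime-divisor; recompute)
import Data.Nat.Coprimality as Coprime
open import Data.Nat.Divisibility using (divides)
open import Data.Nat.Induction using (<-rec)
open import Data.Integer as ℤ using (ℤ; +_; ∣_∣)
import Data.Integer.Properties as ℤ
open import Data.Integer.Tactic.RingSolver using (solve-∀)
open import Data.Product using (Σ; _,_)
open import Data.Rational as ℚ using (_/_; _+_; _*_; -_; 0ℚ; 1ℚ; toℚᵘ; mkℚ)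
open import Data.Rational.Properties
open import Data.Rational.Solver using (module +-*-Solver)
open import Data.Rational.Unnormalised as ℚᵘ using (mkℚᵘ; *≡*) renaming (_≃_ to _≃ᵘ_)
import Data.Rational.Unnormalised.Properties as ℚᵘ
open import Relation.Binary.PropositionalEquality using (refl; sym; trans; cong; cong₂; subst; module ≡-Reasoning)

-- Comparing the coefficients of t^m in (Σ_{j<a} e^{jt}) · Σ G_m t^m/m! = a t and multiplying
-- by m! gives, for m ≥ 2, the recurrence  a G_m = - Σ_{k=1}^{m} C(m,k) S_k G_{m-k}  with the
-- integer power sums S_k = Σ_{j<a} j^k. Starting from G_0 = 0 and G_1 = 1, strong induction
-- shows that a^{m-1} G_m is an integer: in the k-th term, a^{m-1-k} G_{m-k} is an integer by
-- induction and the remaining factor a^{k-1} is one too.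

fromℤ : ℤ → ℚ
fromℤ z = z / 1

fromℕ : ℕ → ℚ
fromℕ n = fromℤ (+ n)

toℚᵘ-/ : ∀ z d → toℚᵘ (z / suc d) ≃ᵘ mkℚᵘ z d
toℚᵘ-/ z d = toℚᵘ-fromℚᵘ (mkℚᵘ z d)

fromℤ-homo-+ : ∀ z w → fromℤ (z ℤ.+ w) ≡ fromℤ z + fromℤ w
fromℤ-homo-+ z w = toℚᵘ-injective (ℚᵘ.≃-trans (toℚᵘ-/ (z ℤ.+ w) 0) (ℚᵘ.≃-sym (ℚᵘ.≃-trans
  (toℚᵘ-homo-+ (fromℤ z) (fromℤ w))
  (ℚᵘ.≃-trans (ℚᵘ.+-cong (toℚᵘ-/ z 0) (toℚᵘ-/ w 0)) (*≡* (ring z w))))))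
  where
  ring : ∀ z w → (z ℤ.* + 1 ℤ.+ w ℤ.* + 1) ℤ.* + 1 ≡ (z ℤ.+ w) ℤ.* (+ 1 ℤ.* + 1)
  ring = solve-∀

fromℤ-homo-* : ∀ z w → fromℤ (z ℤ.* w) ≡ fromℤ z * fromℤ w
fromℤ-homo-* z w = toℚᵘ-injective (ℚᵘ.≃-trans (toℚᵘ-/ (z ℤ.* w) 0) (ℚᵘ.≃-sym (ℚᵘ.≃-trans
  (toℚᵘ-homo-* (fromℤ z) (fromℤ w))
  (ℚᵘ.≃-trans (ℚᵘ.*-cong (toℚᵘ-/ z 0) (toℚᵘ-/ w 0)) (*≡* refl)))))

fromℤ-homo‿- : ∀ z → fromℤ (ℤ.- z) ≡ - fromℤ z
fromℤ-homo‿- z = toℚᵘ-injective (ℚᵘ.≃-trans (toℚᵘ-/ (ℤ.- z) 0) (ℚᵘ.≃-sym (ℚᵘ.≃-trans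
  (toℚᵘ-homo‿- (fromℤ z)) (ℚᵘ.-‿cong (toℚᵘ-/ z 0)))))

fromℕ-homo-* : ∀ m n → fromℕ (m ℕ.* n) ≡ fromℕ m * fromℕ n
fromℕ-homo-* m n = trans (cong fromℤ (ℤ.pos-* m n)) (fromℤ-homo-* (+ m) (+ n))

n*[z/n]≡z : ∀ z n .{{_ : NonZero n}} → fromℕ n * (z / n) ≡ fromℤ z
n*[z/n]≡z z n@(suc d) = toℚᵘ-injective (ℚᵘ.≃-trans
  (ℚᵘ.≃-trans (toℚᵘ-homo-* (fromℕ n) (z / n)) (ℚᵘ.*-cong (toℚᵘ-/ (+ n) 0) (toℚᵘ-/ z d)))
  (ℚᵘ.≃-sym (ℚᵘ.≃-trans (toℚᵘ-/ z 0) (*≡* (ring z (+ n))))))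
  where
  ring : ∀ z n → z ℤ.* (+ 1 ℤ.* n) ≡ (n ℤ.* z) ℤ.* + 1
  ring = solve-∀

*-cancelˡ-fromℕ : ∀ n .{{_ : NonZero n}} {p q} → fromℕ n * p ≡ fromℕ n * q → p ≡ q
*-cancelˡ-fromℕ n {p} {q} np≡nq = begin
  p                         ≡⟨ sym (*-identityˡ p) ⟩
  1ℚ * p                    ≡⟨ cong (_* p) n⁻¹*n≡1 ⟨
  ((+ 1 / n) * fromℕ n) * p ≡⟨ *-assoc (+ 1 / n) (fromℕ n) p ⟩
  (+ 1 / n) * (fromℕ n * p) ≡⟨ cong ((+ 1 / n) *_) np≡nq ⟩
  (+ 1 / n) * (fromℕ n * q) ≡⟨ *-assoc (+ 1 / n) (fromℕ n) q ⟨
  ((+ 1 / n) * fromℕ n) * q ≡⟨ cong (_* q) n⁻¹*n≡1 ⟩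
  1ℚ * q                    ≡⟨ *-identityˡ q ⟩
  q                         ∎
  where
  open ≡-Reasoning
  n⁻¹*n≡1 : (+ 1 / n) * fromℕ n ≡ 1ℚ
  n⁻¹*n≡1 = trans (*-comm (+ 1 / n) (fromℕ n)) (n*[z/n]≡z (+ 1) n)

1/_! : ℕ → ℚ
1/ n ! = (+ 1 / n !) {{n !≢0}}

n!*1/n!≡1 : ∀ n → fromℕ (n !) * 1/ n ! ≡ 1ℚ
n!*1/n!≡1 n = n*[z/n]≡z (+ 1) (n !) {{n !≢0}}

IsInteger : ℚ → Set
IsInteger q = Σ ℤ (λ z → q ≡ fromℤ z)

isInteger-fromℤ : ∀ z → IsInteger (fromℤ z)
isInteger-fromℤ z = z , refl

isInteger-fromℕ : ∀ n → IsInteger (fromℕ n)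
isInteger-fromℕ n = isInteger-fromℤ (+ n)

isInteger-resp-≡ : ∀ {p q} → p ≡ q → IsInteger q → IsInteger p
isInteger-resp-≡ refl q∈ℤ = q∈ℤ

isInteger-+ : ∀ {p q} → IsInteger p → IsInteger q → IsInteger (p + q)
isInteger-+ (z , refl) (w , refl) = z ℤ.+ w , sym (fromℤ-homo-+ z w)

isInteger-* : ∀ {p q} → IsInteger p → IsInteger q → IsInteger (p * q)
isInteger-* (z , refl) (w , refl) = z ℤ.* w , sym (fromℤ-homo-* z w)

isInteger-neg : ∀ {p} → IsInteger p → IsInteger (- p)
isInteger-neg (z , refl) = ℤ.- z , sym (fromℤ-homo‿- z)

isInteger-Σ< : ∀ n f → (∀ k → IsInteger (f k)) → IsInteger (Σ< n f)
isInteger-Σ< zero    f f∈ℤ = isInteger-fromℕ 0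
isInteger-Σ< (suc n) f f∈ℤ = isInteger-+ (isInteger-Σ< n f f∈ℤ) (f∈ℤ n)

isInteger[q*d]⇒↧q∣d : ∀ q d → IsInteger (q * fromℕ d) → ℚ.denominatorℕ q ∣ d
isInteger[q*d]⇒↧q∣d (mkℚ n d-1 coprime) d (z , qd≡z) =
  coprime-divisor (Coprime.sym (recompute coprime)) (divides ∣ z ∣ (∣n∣*d≡∣z∣*[1+d-1] cross))
  where
  q : ℚ
  q = mkℚ n d-1 coprime
  cross : n ℤ.* + d ℤ.* + 1 ≡ z ℤ.* + suc (d-1 ℕ.* 1)
  cross with ℚᵘ.≃-trans (ℚᵘ.≃-sym (ℚᵘ.≃-trans (toℚᵘ-homo-* q (fromℕ d))
                (ℚᵘ.*-cong (ℚᵘ.≃-refl {mkℚᵘ n d-1}) (toℚᵘ-/ (+ d) 0))))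
              (ℚᵘ.≃-trans (toℚᵘ-cong qd≡z) (toℚᵘ-/ z 0))
  ... | *≡* eq = eq
  ∣n∣*d≡∣z∣*[1+d-1] : n ℤ.* + d ℤ.* + 1 ≡ z ℤ.* + suc (d-1 ℕ.* 1) → ∣ n ∣ ℕ.* d ≡ ∣ z ∣ ℕ.* suc d-1
  ∣n∣*d≡∣z∣*[1+d-1] eq = begin
    ∣ n ∣ ℕ.* d                   ≡⟨ ℤ.abs-* n (+ d) ⟨
    ∣ n ℤ.* + d ∣                 ≡⟨ cong ∣_∣ (ℤ.*-identityʳ (n ℤ.* + d)) ⟨
    ∣ n ℤ.* + d ℤ.* + 1 ∣         ≡⟨ cong ∣_∣ eq ⟩
    ∣ z ℤ.* + suc (d-1 ℕ.* 1) ∣   ≡⟨ ℤ.abs-* z (+ suc (d-1 ℕ.* 1)) ⟩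
    ∣ z ∣ ℕ.* suc (d-1 ℕ.* 1)     ≡⟨ cong (λ x → ∣ z ∣ ℕ.* suc x) (ℕ.*-identityʳ d-1) ⟩
    ∣ z ∣ ℕ.* suc d-1             ∎
    where open ≡-Reasoning

m!*n!∣[m+n]! : ∀ m n → m ! ℕ.* n ! ∣ (m ℕ.+ n) !
m!*n!∣[m+n]! m n =
  subst (λ k → m ! ℕ.* k ! ∣ (m ℕ.+ n) !) (ℕ.m+n∸m≡n m n) (k![n∸k]!∣n! (ℕ.m≤m+n m n))

binomial-isInteger : ∀ m n → IsInteger (fromℕ ((m ℕ.+ n) !) * (1/ m ! * 1/ n !))
binomial-isInteger m n with m!*n!∣[m+n]! m n
... | divides C [m+n]!≡C*m!*n! = isInteger-resp-≡ eq (isInteger-fromℕ C)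
  where
  open ≡-Reasoning
  open +-*-Solver using (solve; _:=_; _:*_)
  eq : fromℕ ((m ℕ.+ n) !) * (1/ m ! * 1/ n !) ≡ fromℕ C
  eq = begin
    fromℕ ((m ℕ.+ n) !) * (1/ m ! * 1/ n !)
      ≡⟨ cong (λ k → fromℕ k * (1/ m ! * 1/ n !)) [m+n]!≡C*m!*n! ⟩
    fromℕ (C ℕ.* (m ! ℕ.* n !)) * (1/ m ! * 1/ n !)
      ≡⟨ cong (_* (1/ m ! * 1/ n !)) (trans (fromℕ-homo-* C _) (cong (fromℕ C *_) (fromℕ-homo-* (m !) (n !)))) ⟩
    fromℕ C * (fromℕ (m !) * fromℕ (n !)) * (1/ m ! * 1/ n !)
      ≡⟨ solve 5 (λ c fm fn im in' → c :* (fm :* fn) :* (im :* in') := c :* (fm :* im) :* (fn :* in'))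
           refl (fromℕ C) (fromℕ (m !)) (fromℕ (n !)) (1/ m !) (1/ n !) ⟩
    fromℕ C * (fromℕ (m !) * 1/ m !) * (fromℕ (n !) * 1/ n !)
      ≡⟨ cong₂ (λ x y → fromℕ C * x * y) (n!*1/n!≡1 m) (n!*1/n!≡1 n) ⟩
    fromℕ C * 1ℚ * 1ℚ
      ≡⟨ trans (*-identityʳ _) (*-identityʳ _) ⟩
    fromℕ C ∎

Σ<-cong : ∀ n {f g : ℕ → ℚ} → (∀ k → f k ≡ g k) → Σ< n f ≡ Σ< n g
Σ<-cong zero    f≗g = refl
Σ<-cong (suc n) f≗g = cong₂ _+_ (Σ<-cong n f≗g) (f≗g n)

Σ<-*ʳ : ∀ n f c → Σ< n f * c ≡ Σ< n (λ k → f k * c)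
Σ<-*ʳ zero    f c = *-zeroˡ c
Σ<-*ʳ (suc n) f c = trans (*-distribʳ-+ c (Σ< n f) (f n)) (cong (_+ f n * c) (Σ<-*ʳ n f c))

Σ<-*ˡ : ∀ n f c → c * Σ< n f ≡ Σ< n (λ k → c * f k)
Σ<-*ˡ n f c = trans (*-comm c (Σ< n f)) (trans (Σ<-*ʳ n f c) (Σ<-cong n (λ k → *-comm (f k) c)))

Σ<-suc-head : ∀ n f → Σ< (suc n) f ≡ f 0 + Σ< n (λ k → f (suc k))
Σ<-suc-head zero    f = trans (+-identityˡ (f 0)) (sym (+-identityʳ (f 0)))
Σ<-suc-head (suc n) f = trans (cong (_+ f (suc n)) (Σ<-suc-head n f)) (+-assoc (f 0) _ _)

Σ<-const-1 : ∀ n → Σ< n (λ _ → 1ℚ) ≡ fromℕ n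
Σ<-const-1 zero    = refl
Σ<-const-1 (suc n) = trans (cong (_+ 1ℚ) (Σ<-const-1 n))
  (trans (sym (fromℤ-homo-+ (+ n) (+ 1))) (cong fromℕ (ℕ.+-comm n 1)))

m∸n≡1+o⇒n+[1+o]≡m : ∀ m n {o} → m ∸ n ≡ suc o → n ℕ.+ suc o ≡ m
m∸n≡1+o⇒n+[1+o]≡m (suc m) zero    eq = sym eq
m∸n≡1+o⇒n+[1+o]≡m (suc m) (suc n) eq = cong suc (m∸n≡1+o⇒n+[1+o]≡m m n eq)

module _ (a : ℕ) .{{_ : NonZero a}} (G : ℕ → ℚ)
         (G-egf : ∀ m → (denomSeries a ⋆ egf G) m ≡ atSeries a m) where

  private
    D : Series
    D = denomSeries a

  D0≡a : D 0 ≡ fromℕ a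
  D0≡a = Σ<-const-1 a

  k!*Dk-isInteger : ∀ k → IsInteger (fromℕ (k !) * D k)
  k!*Dk-isInteger k = isInteger-resp-≡
    (trans (Σ<-*ˡ a (λ j → expS j k) (fromℕ (k !)))
           (Σ<-cong a (λ j → n*[z/n]≡z (+ (j ^ k)) (k !) {{k !≢0}})))
    (isInteger-Σ< a _ (λ j → isInteger-fromℕ (j ^ k)))

  recurrence : ∀ m → fromℕ a * egf G m + Σ< m (λ k → D (suc k) * egf G (m ∸ suc k)) ≡ atSeries a m
  recurrence m = trans (sym (trans (Σ<-suc-head m _) (cong (λ x → x * egf G m + S) D0≡a))) (G-egf m)
    where
    S : ℚ
    S = Σ< m (λ k → D (suc k) * egf G (m ∸ suc k))

  egf-G0≡0 : egf G 0 ≡ 0ℚ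
  egf-G0≡0 = *-cancelˡ-fromℕ a (begin
    fromℕ a * egf G 0        ≡⟨ +-identityʳ _ ⟨
    fromℕ a * egf G 0 + 0ℚ   ≡⟨ recurrence 0 ⟩
    0ℚ                       ≡⟨ *-zeroʳ (fromℕ a) ⟨
    fromℕ a * 0ℚ             ∎)
    where open ≡-Reasoning

  egf-G1≡1 : egf G 1 ≡ 1ℚ
  egf-G1≡1 = *-cancelˡ-fromℕ a (begin
    fromℕ a * egf G 1                                 ≡⟨ +-identityʳ _ ⟨
    fromℕ a * egf G 1 + 0ℚ                            ≡⟨ cong (λ x → fromℕ a * egf G 1 + x) D1*egf-G0≡0 ⟨
    fromℕ a * egf G 1 + (0ℚ + D 1 * egf G 0)          ≡⟨ recurrence 1 ⟩
    fromℕ a                                           ≡⟨ *-identityʳ (fromℕ a) ⟨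
    fromℕ a * 1ℚ                                      ∎)
    where
    open ≡-Reasoning
    D1*egf-G0≡0 : 0ℚ + D 1 * egf G 0 ≡ 0ℚ
    D1*egf-G0≡0 = trans (+-identityˡ _) (trans (cong (D 1 *_) egf-G0≡0) (*-zeroʳ (D 1)))

  egf-*-! : ∀ m → egf G m * fromℕ (m !) ≡ G m
  egf-*-! m = begin
    G m * 1/ m ! * fromℕ (m !)   ≡⟨ *-assoc (G m) _ _ ⟩
    G m * (1/ m ! * fromℕ (m !)) ≡⟨ cong (G m *_) (trans (*-comm (1/ m !) (fromℕ (m !))) (n!*1/n!≡1 m)) ⟩
    G m * 1ℚ                     ≡⟨ *-identityʳ (G m) ⟩
    G m                          ∎
    where open ≡-Reasoning

  Scaled : ℕ → Set
  Scaled m = IsInteger (G m * fromℕ (a ^ (m ∸ 1)))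

  scaled-0 : Scaled 0
  scaled-0 = isInteger-resp-≡ (cong (_* 1ℚ) (sym (egf-*-! 0)))
    (isInteger-* (isInteger-* (+ 0 , egf-G0≡0) (isInteger-fromℕ 1)) (isInteger-fromℕ 1))

  scaled-1 : Scaled 1
  scaled-1 = isInteger-resp-≡ (cong (_* 1ℚ) (sym (egf-*-! 1)))
    (isInteger-* (isInteger-* (+ 1 , egf-G1≡1) (isInteger-fromℕ 1)) (isInteger-fromℕ 1))

  clearing : ℕ → ℚ
  clearing m = fromℕ (m !) * fromℕ (a ^ (m ∸ 2))

  term-isInteger : ∀ k i → Scaled (suc i) → IsInteger (D (suc k) * egf G (suc i) * clearing (suc k ℕ.+ suc i))
  term-isInteger k i Gaⁱ∈ℤ = isInteger-resp-≡ eq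
    (isInteger-* (isInteger-* (isInteger-* (binomial-isInteger (suc k) (suc i)) (k!*Dk-isInteger (suc k))) Gaⁱ∈ℤ)
                 (isInteger-fromℕ (a ^ k)))
    where
    open ≡-Reasoning
    open +-*-Solver using (solve; _:=_; _:*_)
    m : ℕ
    m = suc k ℕ.+ suc i
    aᵏ⁺ⁱ : fromℕ (a ^ (m ∸ 2)) ≡ fromℕ (a ^ k) * fromℕ (a ^ i)
    aᵏ⁺ⁱ = trans (cong (λ e → fromℕ (a ^ (e ∸ 1))) (ℕ.+-suc k i))
                 (trans (cong fromℕ (ℕ.^-distribˡ-+-* a k i)) (fromℕ-homo-* (a ^ k) (a ^ i)))
    eq : D (suc k) * egf G (suc i) * clearing m
       ≡ fromℕ (m !) * (1/ suc k ! * 1/ suc i !) * (fromℕ (suc k !) * D (suc k))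
         * (G (suc i) * fromℕ (a ^ i)) * fromℕ (a ^ k)
    eq = begin
      D (suc k) * egf G (suc i) * clearing m
        ≡⟨ cong (λ x → D (suc k) * egf G (suc i) * (fromℕ (m !) * x)) aᵏ⁺ⁱ ⟩
      D (suc k) * (G (suc i) * 1/ suc i !) * (fromℕ (m !) * (fromℕ (a ^ k) * fromℕ (a ^ i)))
        ≡⟨ *-identityʳ _ ⟨
      D (suc k) * (G (suc i) * 1/ suc i !) * (fromℕ (m !) * (fromℕ (a ^ k) * fromℕ (a ^ i))) * 1ℚ
        ≡⟨ cong (D (suc k) * (G (suc i) * 1/ suc i !) * (fromℕ (m !) * (fromℕ (a ^ k) * fromℕ (a ^ i))) *_) (n!*1/n!≡1 (suc k)) ⟨
      D (suc k) * (G (suc i) * 1/ suc i !) * (fromℕ (m !) * (fromℕ (a ^ k) * fromℕ (a ^ i)))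
        * (fromℕ (suc k !) * 1/ suc k !)
        ≡⟨ solve 8 (λ d g ii mm ak ai kk ik →
                      d :* (g :* ii) :* (mm :* (ak :* ai)) :* (kk :* ik)
                   := mm :* (ik :* ii) :* (kk :* d) :* (g :* ai) :* ak)
             refl (D (suc k)) (G (suc i)) (1/ suc i !) (fromℕ (m !)) (fromℕ (a ^ k)) (fromℕ (a ^ i))
                  (fromℕ (suc k !)) (1/ suc k !) ⟩
      fromℕ (m !) * (1/ suc k ! * 1/ suc i !) * (fromℕ (suc k !) * D (suc k))
        * (G (suc i) * fromℕ (a ^ i)) * fromℕ (a ^ k) ∎

  scaled-step : ∀ p → (∀ {j} → j < 2 ℕ.+ p → Scaled j) → Scaled (2 ℕ.+ p)
  scaled-step p IH = isInteger-resp-≡ eq (isInteger-neg (isInteger-Σ< m (λ k → T k * clearing m) term))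
    where
    open ≡-Reasoning
    open +-*-Solver using (solve; _:=_; _:*_)
    m : ℕ
    m = 2 ℕ.+ p
    T : ℕ → ℚ
    T k = D (suc k) * egf G (m ∸ suc k)
    term : ∀ k → IsInteger (T k * clearing m)
    term k with m ∸ suc k in m-k-1≡j
    ... | zero  = isInteger-resp-≡
      (trans (cong (λ x → D (suc k) * x * clearing m) egf-G0≡0)
             (trans (cong (_* clearing m) (*-zeroʳ (D (suc k)))) (*-zeroˡ (clearing m))))
      (isInteger-fromℕ 0)
    ... | suc i = subst (λ n → IsInteger (D (suc k) * egf G (suc i) * clearing (suc n)))
                        (m∸n≡1+o⇒n+[1+o]≡m (suc p) k {i} m-k-1≡j)
                        (term-isInteger k i (IH (s≤s (ℕ.≤-trans (ℕ.≤-reflexive (sym m-k-1≡j)) (ℕ.m∸n≤m (suc p) k)))))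
    S : ℚ
    S = Σ< m T
    eq : G m * fromℕ (a ^ (m ∸ 1)) ≡ - Σ< m (λ k → T k * clearing m)
    eq = begin
      G m * fromℕ (a ℕ.* a ^ p)
        ≡⟨ cong₂ _*_ (egf-*-! m) (sym (fromℕ-homo-* a (a ^ p))) ⟨
      egf G m * fromℕ (m !) * (fromℕ a * fromℕ (a ^ p))
        ≡⟨ solve 4 (λ g f A ap → g :* f :* (A :* ap) := A :* g :* (f :* ap))
             refl (egf G m) (fromℕ (m !)) (fromℕ a) (fromℕ (a ^ p)) ⟩
      fromℕ a * egf G m * clearing m
        ≡⟨ cong (_* clearing m) (inverseˡ-unique +-0-group (fromℕ a * egf G m) S (recurrence m)) ⟩
      - S * clearing m
        ≡⟨ neg-distribˡ-* S (clearing m) ⟨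
      - (S * clearing m)
        ≡⟨ cong -_ (Σ<-*ʳ m T (clearing m)) ⟩
      - Σ< m (λ k → T k * clearing m) ∎

  scaled : ∀ n → Scaled n
  scaled = <-rec Scaled step
    where
    step : ∀ n → (∀ {j} → j < n → Scaled j) → Scaled n
    step zero          _  = scaled-0
    step (suc zero)    _  = scaled-1
    step (suc (suc p)) IH = scaled-step p IH

proposition2 : (a n : ℕ) → 2 ≤ a → 1 ≤ n → (G : ℕ → ℚ)
    → (∀ m → (denomSeries a ⋆ egf G) m ≡ atSeries a m)
    → ℚ.denominatorℕ (G n) ∣ a ^ (n ∸ 1)
proposition2 a@(suc _) n _ _ G G-egf = isInteger[q*d]⇒↧q∣d (G n) (a ^ (n ∸ 1)) (scaled a G G-egf n)
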